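{- If $\emptyset;\delta\vdash S$ for some clock constraint $\delta$, and the configuration $(\nu,S)$ is future-enabled (i.e. there exist $t\ge0$, $c\in\{!,?\}$ and a message $m$ with $(\nu,S)\xrightarrow{t}\xrightarrow{c\,m}$), then $(\nu,S)$ is well-formed.
   Context: Clocks, valuations $\nu:\mathcal X\to\mathbb{R}_{\ge0}$, $\nu+t$, resets $\nu[\lambda\mapsto0]$; clock constraints $\delta ::= \mathrm{true} \mid x>n \mid x=n \mid x-y>n \mid x-y=n \mid \neg\delta \mid \delta_1\wedge\delta_2$ ($n\in\mathbb N$); $\nu\models\downarrow\delta$ iff $\exists t\ge0.\ \nu+t\models\delta$; $\delta[\lambda\mapsto 0]\models\gamma$ means $\nu[\lambda\mapsto0]\models\gamma$ whenever $\nu\models\delta$. Types: $S ::= \{c_i\, l_i\langle T_i\rangle(\delta_i,\lambda_i).S_i\}_{i\in I} \mid \mu\alpha.S \mid \alpha \mid \mathrm{end}$ ($I\ne\emptyset$, $c_i\in\{!,?\}$, pairwise distinct labels, $T_i$ a base sort or delegation $(\delta',S')$, contractive recursion). Messages are $m=l\langle T\rangle$. Well-formedness rules for $A;\delta\vdash S$ ($A$ maps recursion variables to constraints): (end) $A;\mathrm{true}\vdash\mathrm{end}$; (rec) $A;\delta\vdash\mu\alpha.S$ if $A,\alpha:\delta;\delta\vdash S$; (var) $A,\alpha:\delta;\delta\vdash\alpha$; (choice) $A;\downarrow(\bigvee_i\delta_i)\vdash\{c_i l_i\langle T_i\rangle(\delta_i,\lambda_i).S_i\}_{i\in I}$ if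 for each $i$ some $\gamma_i$ satisfies $A;\gamma_i\vdash S_i$ and $\delta_i[\lambda_i\mapsto0]\models\gamma_i$, for all $i\ne j$ either $\delta_i\wedge\delta_j\models\mathrm{false}$ or $c_i=c_j$, and each delegated $T_i=(\delta',S')$ has some $\gamma'$ with $\emptyset;\gamma'\vdash S'$, $\delta'\models\gamma'$. $(\nu,S)$ is well-formed if $\emptyset;\delta'\vdash S$ and $\nu\models\delta'$ for some $\delta'$. Configuration transitions: (act) $(\nu,\{c_i l_i\langle T_i\rangle(\delta_i,\lambda_i).S_i\}_{i\in I})\xrightarrow{c_j l_j\langle T_j\rangle}(\nu[\lambda_j\mapsto0],S_j)$ if $j\in I$, $\nu\models\delta_j$; (unfold) $(\nu,\mu\alpha.S)\xrightarrow{\ell}C'$ if $(\nu,S[\mu\alpha.S/\alpha])\xrightarrow{\ell}C'$; (tick) $(\nu,S)\xrightarrow{t}(\nu+t,S)$. -}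

module Defs where

open import Data.Nat using (ℕ)
import Data.Nat as ℕ
open import Data.Fin using (Fin)
open import Data.List using (List; []; _∷_; map; length; lookup)
open import Data.List.Relation.Unary.Any using (any?)
open import Data.List.Relation.Unary.Unique.Propositional using (Unique)
open import Data.Product using (Σ; ∃; ∃-syntax; _×_; _,_)
open import Data.Sum using (_⊎_)
open import Data.Maybe using (Maybe; just; nothing)
open import Data.Empty using (⊥)
open import Data.Unit using (⊤)
open import Data.Bool using (if_then_else_)
open import Relation.Nullary using (¬_)
open import Relation.Nullary.Decidable using (⌊_⌋)
open import Relation.Binary.PropositionalEquality using (_≡_; _≢_)
open import Relation.Binary.Definitions using (DecidableEquality)

-- Ambient data. The paper uses Time = ℝ≥0; the standard library has no
-- reals, so the time domain is abstract.
record Setting : Set₁ where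
  field
    Time  : Set
    _+ᵗ_  : Time → Time → Time
    ι     : ℕ → Time
    _<ᵗ_  : Time → Time → Set
    Clock : Set
    _≟ᶜ_  : DecidableEquality Clock
    Base  : Set

module Theory (𝒮 : Setting) where
  open Setting 𝒮

  Valuation : Set
  Valuation = Clock → Time

  _+ᵛ_ : Valuation → Time → Valuation
  (ν +ᵛ t) x = ν x +ᵗ t

  reset : Valuation → List Clock → Valuation
  reset ν λs x = if ⌊ any? (x ≟ᶜ_) λs ⌋ then ι 0 else ν x

  -- clock constraints (with ↓ added, as used in the (choice) rule)
  data Constraint : Set where
    tt    : Constraint
    _>ₙ_  : Clock → ℕ → Constraint
    _=ₙ_  : Clock → ℕ → Constraint
    diff> : Clock → Clock → ℕ → Constraint
    diff= : Clock → Clock → ℕ → Constraint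
    ¬c    : Constraint → Constraint
    _∧c_  : Constraint → Constraint → Constraint
    ↓     : Constraint → Constraint

  ff : Constraint
  ff = ¬c tt

  _∨c_ : Constraint → Constraint → Constraint
  δ ∨c γ = ¬c (¬c δ ∧c ¬c γ)

  ⋁ : List Constraint → Constraint
  ⋁ []       = ff
  ⋁ (δ ∷ δs) = δ ∨c ⋁ δs

  _⊨_ : Valuation → Constraint → Set
  ν ⊨ tt           = ⊤
  ν ⊨ (x >ₙ n)     = ι n <ᵗ ν x
  ν ⊨ (x =ₙ n)     = ν x ≡ ι n
  ν ⊨ diff> x y n  = (ν y +ᵗ ι n) <ᵗ ν x
  ν ⊨ diff= x y n  = ν x ≡ (ν y +ᵗ ι n)
  ν ⊨ ¬c δ         = ¬ (ν ⊨ δ)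
  ν ⊨ (δ ∧c γ)     = (ν ⊨ δ) × (ν ⊨ γ)
  ν ⊨ ↓ δ          = ∃[ t ] ((ν +ᵛ t) ⊨ δ)

  _⊨ᶜ_ : Constraint → Constraint → Set
  δ ⊨ᶜ γ = ∀ ν → ν ⊨ δ → ν ⊨ γ

  _[_↦0]⊨_ : Constraint → List Clock → Constraint → Set
  δ [ λs ↦0]⊨ γ = ∀ ν → ν ⊨ δ → reset ν λs ⊨ γ

  data Dir : Set where
    ‼ ⁇ : Dir

  RecVar : Set
  RecVar = ℕ

  Label : Set
  Label = ℕ

  mutual
    data SType : Set where
      choice : List Branch → SType
      μ      : RecVar → SType → SType
      var    : RecVar → SType
      end    : SType

    data Branch : Set where
      br : Dir → Label → Sort → Constraint → List Clock → SType → Branch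

    data Sort : Set where
      base  : Base → Sort
      deleg : Constraint → SType → Sort

  dir : Branch → Dir
  dir (br c _ _ _ _ _) = c
  label : Branch → Label
  label (br _ l _ _ _ _) = l
  sort : Branch → Sort
  sort (br _ _ T _ _ _) = T
  guard : Branch → Constraint
  guard (br _ _ _ δ _ _) = δ
  resets : Branch → List Clock
  resets (br _ _ _ _ λs _) = λs
  cont : Branch → SType
  cont (br _ _ _ _ _ S) = S

  -- syntactic side conditions on types: non-empty choices, pairwise
  -- distinct labels, contractive recursion
  NotVarHead : SType → Set
  NotVarHead (var _) = ⊥
  NotVarHead (μ _ S) = NotVarHead S
  NotVarHead _       = ⊤

  NonEmpty : List Branch → Set
  NonEmpty []      = ⊥
  NonEmpty (_ ∷ _) = ⊤

  mutual
    ValidType : SType → Set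
    ValidType (choice bs) = NonEmpty bs × Unique (map label bs) × ValidBs bs
    ValidType (μ _ S)     = NotVarHead S × ValidType S
    ValidType (var _)     = ⊤
    ValidType end         = ⊤

    ValidBs : List Branch → Set
    ValidBs []       = ⊤
    ValidBs (b ∷ bs) = ValidB b × ValidBs bs

    ValidB : Branch → Set
    ValidB (br _ _ T _ _ S) = ValidSort T × ValidType S

    ValidSort : Sort → Set
    ValidSort (base _)    = ⊤
    ValidSort (deleg _ S) = ValidType S

  mutual
    _[_/_] : SType → SType → RecVar → SType
    choice bs [ R / α ] = choice (substBs bs R α)
    μ β S [ R / α ]     = if ⌊ β ℕ.≟ α ⌋ then μ β S else μ β (S [ R / α ])
    var β [ R / α ]     = if ⌊ β ℕ.≟ α ⌋ then R else var β
    end [ R / α ]       = end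

    substBs : List Branch → SType → RecVar → List Branch
    substBs []       R α = []
    substBs (b ∷ bs) R α = substB b R α ∷ substBs bs R α

    substB : Branch → SType → RecVar → Branch
    substB (br c l T δ λs S) R α = br c l (substS T R α) δ λs (S [ R / α ])

    substS : Sort → SType → RecVar → Sort
    substS (base b)    R α = base b
    substS (deleg δ S) R α = deleg δ (S [ R / α ])

  Env : Set
  Env = List (RecVar × Constraint)

  lookupEnv : Env → RecVar → Maybe Constraint
  lookupEnv []            α = nothing
  lookupEnv ((β , δ) ∷ A) α = if ⌊ β ℕ.≟ α ⌋ then just δ else lookupEnv A α

  data _⨾_⊢_ : Env → Constraint → SType → Set where
    ⊢end : ∀ {A} → A ⨾ tt ⊢ end
    ⊢rec : ∀ {A δ α S} → ((α , δ) ∷ A) ⨾ δ ⊢ S → A ⨾ δ ⊢ μ α S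
    ⊢var : ∀ {A δ α} → lookupEnv A α ≡ just δ → A ⨾ δ ⊢ var α
    ⊢choice : ∀ {A bs} →
      (∀ (i : Fin (length bs)) →
         ∃[ γ ] ((A ⨾ γ ⊢ cont (lookup bs i))
                 × (guard (lookup bs i) [ resets (lookup bs i) ↦0]⊨ γ))) →
      (∀ (i j : Fin (length bs)) → i ≢ j →
         ((guard (lookup bs i) ∧c guard (lookup bs j)) ⊨ᶜ ff)
         ⊎ (dir (lookup bs i) ≡ dir (lookup bs j))) →
      (∀ (i : Fin (length bs)) {δ′ S′} → sort (lookup bs i) ≡ deleg δ′ S′ →
         ∃[ γ′ ] (([] ⨾ γ′ ⊢ S′) × (δ′ ⊨ᶜ γ′))) →
      A ⨾ ↓ (⋁ (map guard bs)) ⊢ choice bs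

  Config : Set
  Config = Valuation × SType

  data Act : Set where
    tick : Time → Act
    act  : Dir → Label → Sort → Act

  data _—[_]→_ : Config → Act → Config → Set where
    →act : ∀ {ν bs} (j : Fin (length bs)) → ν ⊨ guard (lookup bs j) →
      (ν , choice bs) —[ act (dir (lookup bs j)) (label (lookup bs j)) (sort (lookup bs j)) ]→
      (reset ν (resets (lookup bs j)) , cont (lookup bs j))
    →unfold : ∀ {ν α S ℓ C′} → (ν , (S [ μ α S / α ])) —[ ℓ ]→ C′ → (ν , μ α S) —[ ℓ ]→ C′
    →tick : ∀ {ν S t} → (ν , S) —[ tick t ]→ (ν +ᵛ t , S)

  FutureEnabled : Config → Set
  FutureEnabled C = ∃[ t ] ∃[ c ] ∃[ l ] ∃[ T ] ∃[ C₁ ] ∃[ C₂ ]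
    ((C —[ tick t ]→ C₁) × (C₁ —[ act c l T ]→ C₂))

  WellFormedConfig : Config → Set
  WellFormedConfig (ν , S) = ∃[ δ′ ] (([] ⨾ δ′ ⊢ S) × (ν ⊨ δ′))

module Submission where

open import Defs
open import Data.List using ([]; _∷_; map; lookup)
open import Data.Product using (_,_; proj₁; _×_)
open import Data.Fin using (zero; suc)
open import Data.Unit using (tt)
open import Data.Bool using (true; false)
open import Relation.Nullary.Decidable using (⌊_⌋)
open import Relation.Binary.PropositionalEquality using (_≡_; refl; subst; trans; cong)
import Data.Nat as ℕ

-- In a contractive type every unfolding exposes the same choice, so the
-- disjunction of its guards (the head guard) is invariant under unfolding
-- and under time passing.  An action is possible only when some guard holds,
-- so a future-enabled (ν, S) satisfies ↓ (head guard), and for a contractive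
-- well-formed S the constraint of the judgement is exactly that (or true for
-- end): the given δ itself witnesses well-formedness.

module _ (𝒮 : Setting) where
  open Theory 𝒮

  -- A variable head has no guards; it never occurs for contractive closed types.
  headGuard : SType → Constraint
  headGuard (choice bs) = ⋁ (map guard bs)
  headGuard (μ _ S)     = headGuard S
  headGuard (var _)     = ff
  headGuard end         = ff

  map-guard-substBs : ∀ bs R α → map guard (substBs bs R α) ≡ map guard bs
  map-guard-substBs []                      R α = refl
  map-guard-substBs (br c l T δ λs S ∷ bs) R α = cong (δ ∷_) (map-guard-substBs bs R α)

  headGuard-subst : ∀ S R α → NotVarHead S → headGuard (S [ R / α ]) ≡ headGuard S
  headGuard-subst (choice bs) R α _ = cong ⋁ (map-guard-substBs bs R α)
  headGuard-subst (μ β S)     R α nv with ⌊ β ℕ.≟ α ⌋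
  ... | true  = refl
  ... | false = headGuard-subst S R α nv
  headGuard-subst end         R α _ = refl

  NotVarHead-subst : ∀ S R α → NotVarHead S → NotVarHead (S [ R / α ])
  NotVarHead-subst (choice bs) R α _ = tt
  NotVarHead-subst (μ β S)     R α nv with ⌊ β ℕ.≟ α ⌋
  ... | true  = nv
  ... | false = NotVarHead-subst S R α nv
  NotVarHead-subst end         R α _ = tt

  lookup-guard⇒⋁ : ∀ {ν} bs j → ν ⊨ guard (lookup bs j) → ν ⊨ ⋁ (map guard bs)
  lookup-guard⇒⋁ (b ∷ bs) zero    ν⊨b (ν⊭b , _)  = ν⊭b ν⊨b
  lookup-guard⇒⋁ (b ∷ bs) (suc j) ν⊨b (_ , ν⊭bs) = ν⊭bs (lookup-guard⇒⋁ bs j ν⊨b)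

  act⇒headGuard : ∀ {ν S c l T C} → NotVarHead S →
    (ν , S) —[ act c l T ]→ C → ν ⊨ headGuard S
  act⇒headGuard {ν} {choice bs} _  (→act j ν⊨gⱼ) = lookup-guard⇒⋁ bs j ν⊨gⱼ
  act⇒headGuard {ν} {μ α S}     nv (→unfold step) =
    subst (ν ⊨_) (headGuard-subst S (μ α S) α nv)
      (act⇒headGuard (NotVarHead-subst S (μ α S) α nv) step)

  tick-preserves-headGuard : ∀ {ν S t ν₁ S₁} → NotVarHead S →
    (ν , S) —[ tick t ]→ (ν₁ , S₁) →
    ν₁ ≡ ν +ᵛ t × headGuard S₁ ≡ headGuard S × NotVarHead S₁
  tick-preserves-headGuard nv →tick = refl , refl , nv
  tick-preserves-headGuard {S = μ α S} nv (→unfold step)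
    with tick-preserves-headGuard (NotVarHead-subst S (μ α S) α nv) step
  ... | ν₁≡ν+t , same , nv₁ = ν₁≡ν+t , trans same (headGuard-subst S (μ α S) α nv) , nv₁

  futureEnabled⇒↓headGuard : ∀ {ν S} → NotVarHead S →
    FutureEnabled (ν , S) → ν ⊨ ↓ (headGuard S)
  futureEnabled⇒↓headGuard {ν} nv (t , _ , _ , _ , (ν₁ , S₁) , _ , ticked , acted)
    with tick-preserves-headGuard nv ticked
  ... | refl , same , nv₁ = t , subst ((ν +ᵛ t) ⊨_) same (act⇒headGuard nv₁ acted)

  ↓headGuard⇒⊢constraint : ∀ {A δ S ν} → A ⨾ δ ⊢ S → NotVarHead S →
    ν ⊨ ↓ (headGuard S) → ν ⊨ δ
  ↓headGuard⇒⊢constraint ⊢end            _  _ = tt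
  ↓headGuard⇒⊢constraint (⊢rec ⊢S)       nv h = ↓headGuard⇒⊢constraint ⊢S nv h
  ↓headGuard⇒⊢constraint (⊢choice _ _ _) _  h = h

  closed-valid⇒NotVarHead : ∀ {δ S} → [] ⨾ δ ⊢ S → ValidType S → NotVarHead S
  closed-valid⇒NotVarHead ⊢end            _ = tt
  closed-valid⇒NotVarHead (⊢rec _)        v = proj₁ v
  closed-valid⇒NotVarHead (⊢var ())       _
  closed-valid⇒NotVarHead (⊢choice _ _ _) _ = tt

lemmaA17 : (𝒮 : Setting) → let open Theory 𝒮 in
    ∀ (ν : Valuation) (S : SType) (δ : Constraint) →
    ValidType S → [] ⨾ δ ⊢ S → FutureEnabled (ν , S) → WellFormedConfig (ν , S)
lemmaA17 𝒮 ν S δ valid ⊢S enabled =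
  δ , ⊢S , ↓headGuard⇒⊢constraint 𝒮 ⊢S nv (futureEnabled⇒↓headGuard 𝒮 nv enabled)
  where
  nv : Theory.NotVarHead 𝒮 S
  nv = closed-valid⇒NotVarHead 𝒮 ⊢S valid
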